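{- Let $(G=(V,E,w),U,k)$ be an instance of DS-$k$R with $k\le c|U|$ for some $c\in(0,1)$ and $k\le n-|U|$. If $C$ is the output of an $\alpha_k$-approximation algorithm for $k$-Densify run on $(G,U,k)$, then $C$ is a $\frac{1-c}{1+c}\alpha_k$-approximate solution for DS-$k$R on $(G,U,k)$.
   Context: $G=(V,E,w)$ is an undirected graph with non-negative edge weights, $n=|V|$. $w(E[S])$ is the total weight of edges inside $S$, $d(S)=w(E[S])/|S|$, $\triangle$ is symmetric difference. $k$-Densify: given $G$, $U\subseteq V$, $k$, find $C\subseteq V$ with $|C|=k$ maximizing $w(E[U\triangle C])$. DS-$k$R: given $G$, $U$, $k$, find $C\subseteq V$ with $|C|=k$ maximizing $d(U\triangle C)$. An $\alpha$-approximate solution has value at least $\alpha$ times the optimum.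
   Formalization: The edge weights, the constant c and the approximation ratio $\alpha_k$ are rational. -}

module Defs where

open import Data.Nat as ℕ using (ℕ; zero; suc)
open import Data.Bool using (Bool; true; false; _∧_; _xor_; if_then_else_)
open import Data.Fin using (Fin; toℕ)
open import Data.Vec using (Vec; lookup; zipWith)
open import Data.List using (List; foldr; map; allFin)
open import Data.Integer using (+_)
open import Data.Rational using (ℚ; 0ℚ; _+_; _*_; _/_)
open import Data.Fin.Subset using (Subset; ∣_∣)

-- A weighted graph on vertex set V = Fin n: the weight of the edge {i,j}
-- (i ≠ j) is  w i j  for toℕ i < toℕ j  (weight 0 = no edge).
Weights : ℕ → Set
Weights n = Fin n → Fin n → ℚ

NonNegWeights : ∀ {n} → Weights n → Set
NonNegWeights {n} w = ∀ (i j : Fin n) → 0ℚ Data.Rational.≤ w i j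

sumℚ : List ℚ → ℚ
sumℚ = foldr _+_ 0ℚ

_△_ : ∀ {n} → Subset n → Subset n → Subset n
U △ C = zipWith _xor_ U C

edgeWeight : ∀ {n} → Weights n → Subset n → ℚ
edgeWeight {n} w S =
  sumℚ (map (λ i → sumℚ (map (λ j →
    if (toℕ i ℕ.<ᵇ toℕ j) ∧ lookup S i ∧ lookup S j then w i j else 0ℚ)
    (allFin n))) (allFin n))

-- d(S) = w(E[S]) / |S|   (convention: d(∅) = 0)
density : ∀ {n} → Weights n → Subset n → ℚ
density w S with ∣ S ∣
... | zero  = 0ℚ
... | suc m = edgeWeight w S * (+ 1 / suc m)

ℕ→ℚ : ℕ → ℚ
ℕ→ℚ m = + m / 1

-- Since |C| = k, every U △ C has between |U| - k and |U| + k elements, and k ≤ c|U| gives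
-- (1 - c)(|U| + k) ≤ (1 + c)(|U| - k). So |U △ C| and |U △ C'| are within a factor
-- (1 + c)/(1 - c) of each other, and dividing the α-approximation of the edge weights by
-- these sizes loses at most this factor.
module Submission where

open import Defs
open import Data.Nat using (ℕ; zero; suc)
import Data.Nat as ℕ
import Data.Nat.Properties as ℕ
open import Data.Nat.Coprimality as Coprimality using (1-coprimeTo)
open import Data.Bool using (true; false; if_then_else_; _xor_)
open import Data.Bool.Properties using (xor-assoc; xor-same; xor-identityʳ)
open import Data.Vec using ([]; _∷_)
open import Data.List using ([]; _∷_; map; allFin)
open import Data.Integer as ℤ using (+_)
import Data.Integer.Properties as ℤ
open import Data.Rational
  using (ℚ; 0ℚ; 1ℚ; _<_; _≤_; _*_; _-_; _+_; -_; _/_; mkℚ; *≤*; nonNegative; positive)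
open import Data.Rational.Properties
open import Data.Rational.Solver using (module +-*-Solver)
open import Data.Fin.Subset using (Subset; ∣_∣)
open import Data.Empty using (⊥-elim)
open import Relation.Binary.PropositionalEquality
  using (_≡_; refl; sym; trans; cong; cong₂; subst; subst₂; module ≡-Reasoning)

open +-*-Solver using (solve; _:=_; con; _:+_; _:*_; _:-_)

ℕ→ℚ-canonical : ∀ m → ℕ→ℚ m ≡ mkℚ (+ m) 0 (Coprimality.sym (1-coprimeTo m))
ℕ→ℚ-canonical m = ↥p/↧p≡p _

ℕ→ℚ-+ : ∀ a b → ℕ→ℚ (a ℕ.+ b) ≡ ℕ→ℚ a + ℕ→ℚ b
ℕ→ℚ-+ a b rewrite ℕ→ℚ-canonical a | ℕ→ℚ-canonical b =
  /-cong (sym (cong₂ ℤ._+_ (ℤ.*-identityʳ (+ a)) (ℤ.*-identityʳ (+ b)))) refl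

ℕ→ℚ-mono-≤ : ∀ {a b} → a ℕ.≤ b → ℕ→ℚ a ≤ ℕ→ℚ b
ℕ→ℚ-mono-≤ {a} {b} a≤b rewrite ℕ→ℚ-canonical a | ℕ→ℚ-canonical b =
  *≤* (ℤ.*-monoʳ-≤-nonNeg (+ 1) (ℤ.+≤+ a≤b))

ℕ→ℚ-suc-pos : ∀ m → 0ℚ < ℕ→ℚ (suc m)
ℕ→ℚ-suc-pos m rewrite ℕ→ℚ-canonical (suc m) = positive⁻¹ _

1/suc-*-ℕ→ℚ : ∀ m → (+ 1 / suc m) * ℕ→ℚ (suc m) ≡ 1ℚ
1/suc-*-ℕ→ℚ m rewrite ℕ→ℚ-canonical (suc m) | ↥p/↧p≡p (mkℚ (+ 1) m (1-coprimeTo (suc m))) =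
  *-inverseˡ (mkℚ (+ suc m) 0 (Coprimality.sym (1-coprimeTo (suc m))))

△-cancelʳ : ∀ {n} (p q : Subset n) → (p △ q) △ q ≡ p
△-cancelʳ [] [] = refl
△-cancelʳ (x ∷ p) (y ∷ q) = cong₂ _∷_ xor-cancelʳ (△-cancelʳ p q)
  where
  xor-cancelʳ : (x xor y) xor y ≡ x
  xor-cancelʳ = trans (xor-assoc x y y) (trans (cong (x xor_) (xor-same y)) (xor-identityʳ x))

∣p△q∣≤∣p∣+∣q∣ : ∀ {n} (p q : Subset n) → ∣ p △ q ∣ ℕ.≤ ∣ p ∣ ℕ.+ ∣ q ∣
∣p△q∣≤∣p∣+∣q∣ [] [] = ℕ.z≤n
∣p△q∣≤∣p∣+∣q∣ (true ∷ p) (true ∷ q) =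
  ℕ.≤-trans (∣p△q∣≤∣p∣+∣q∣ p q) (ℕ.+-mono-≤ (ℕ.n≤1+n ∣ p ∣) (ℕ.n≤1+n ∣ q ∣))
∣p△q∣≤∣p∣+∣q∣ (true ∷ p) (false ∷ q) = ℕ.s≤s (∣p△q∣≤∣p∣+∣q∣ p q)
∣p△q∣≤∣p∣+∣q∣ (false ∷ p) (true ∷ q) rewrite ℕ.+-suc ∣ p ∣ ∣ q ∣ = ℕ.s≤s (∣p△q∣≤∣p∣+∣q∣ p q)
∣p△q∣≤∣p∣+∣q∣ (false ∷ p) (false ∷ q) = ∣p△q∣≤∣p∣+∣q∣ p q

∣p∣≤∣p△q∣+∣q∣ : ∀ {n} (p q : Subset n) → ∣ p ∣ ℕ.≤ ∣ p △ q ∣ ℕ.+ ∣ q ∣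
∣p∣≤∣p△q∣+∣q∣ p q = subst (λ r → ∣ r ∣ ℕ.≤ ∣ p △ q ∣ ℕ.+ ∣ q ∣) (△-cancelʳ p q)
  (∣p△q∣≤∣p∣+∣q∣ (p △ q) q)

p≤p+q : ∀ {p q} → 0ℚ ≤ q → p ≤ p + q
p≤p+q {p} {q} 0≤q = begin
  p       ≡⟨ sym (+-identityʳ p) ⟩
  p + 0ℚ  ≤⟨ +-monoʳ-≤ p 0≤q ⟩
  p + q   ∎
  where open ≤-Reasoning

p≤q⇒0≤q-p : ∀ {p q} → p ≤ q → 0ℚ ≤ q - p
p≤q⇒0≤q-p {p} {q} p≤q = begin
  0ℚ     ≡⟨ sym (+-inverseʳ p) ⟩
  p - p  ≤⟨ +-monoˡ-≤ (- p) p≤q ⟩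
  q - p  ∎
  where open ≤-Reasoning

p<q⇒0<q-p : ∀ {p q} → p < q → 0ℚ < q - p
p<q⇒0<q-p {p} {q} p<q = begin-strict
  0ℚ     ≡⟨ sym (+-inverseʳ p) ⟩
  p - p  <⟨ +-monoˡ-< (- p) p<q ⟩
  q - p  ∎
  where open ≤-Reasoning

0≤1+p : ∀ {p} → 0ℚ ≤ p → 0ℚ ≤ 1ℚ + p
0≤1+p 0≤p = ≤-trans (nonNegative⁻¹ 1ℚ) (p≤p+q 0≤p)

p≤q+r⇒p-r≤q : ∀ {p q r} → p ≤ q + r → p - r ≤ q
p≤q+r⇒p-r≤q {p} {q} {r} p≤q+r = begin
  p - r        ≤⟨ +-monoˡ-≤ (- r) p≤q+r ⟩
  q + r - r    ≡⟨ solve 2 (λ q r → q :+ r :- r := q) refl q r ⟩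
  q            ∎
  where open ≤-Reasoning

size-ratio-≤ : ∀ {c u K p q} → 0ℚ ≤ c → c ≤ 1ℚ → K ≤ c * u →
  q ≤ u + K → u ≤ p + K → (1ℚ - c) * q ≤ (1ℚ + c) * p
size-ratio-≤ {c} {u} {K} {p} {q} 0≤c c≤1 K≤cu q≤u+K u≤p+K = begin
  (1ℚ - c) * q                                        ≤⟨ *-monoˡ-≤-nonNeg (1ℚ - c) q≤u+K ⟩
  (1ℚ - c) * (u + K)                                  ≤⟨ p≤p+q (+-mono-≤ 0≤cu-K 0≤cu-K) ⟩
  (1ℚ - c) * (u + K) + ((c * u - K) + (c * u - K))    ≡⟨ gap c u K ⟩
  (1ℚ + c) * (u - K)                                  ≤⟨ *-monoˡ-≤-nonNeg (1ℚ + c) (p≤q+r⇒p-r≤q u≤p+K) ⟩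
  (1ℚ + c) * p                                        ∎
  where
  open ≤-Reasoning
  instance
    _ = nonNegative (p≤q⇒0≤q-p c≤1)
    _ = nonNegative (0≤1+p 0≤c)
  0≤cu-K : 0ℚ ≤ c * u - K
  0≤cu-K = p≤q⇒0≤q-p K≤cu
  gap : ∀ c u K → (1ℚ - c) * (u + K) + ((c * u - K) + (c * u - K)) ≡ (1ℚ + c) * (u - K)
  gap = solve 3 (λ c u K →
    (con 1ℚ :- c) :* (u :+ K) :+ ((c :* u :- K) :+ (c :* u :- K)) := (con 1ℚ :+ c) :* (u :- K)) refl

∣U△C∣-ratio-≤ : ∀ {n} (U C C' : Subset n) {k c} → 0ℚ ≤ c → c ≤ 1ℚ →
  ℕ→ℚ k ≤ c * ℕ→ℚ ∣ U ∣ → ∣ C ∣ ≡ k → ∣ C' ∣ ≡ k →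
  (1ℚ - c) * ℕ→ℚ ∣ U △ C ∣ ≤ (1ℚ + c) * ℕ→ℚ ∣ U △ C' ∣
∣U△C∣-ratio-≤ U C C' {k} 0≤c c≤1 k≤cu ∣C∣≡k ∣C'∣≡k = size-ratio-≤ 0≤c c≤1 k≤cu
  (ℕ→ℚ-mono-≤-+ ∣ U ∣ k (subst (λ m → ∣ U △ C ∣ ℕ.≤ ∣ U ∣ ℕ.+ m) ∣C∣≡k (∣p△q∣≤∣p∣+∣q∣ U C)))
  (ℕ→ℚ-mono-≤-+ ∣ U △ C' ∣ k (subst (λ m → ∣ U ∣ ℕ.≤ ∣ U △ C' ∣ ℕ.+ m) ∣C'∣≡k (∣p∣≤∣p△q∣+∣q∣ U C')))
  where
  ℕ→ℚ-mono-≤-+ : ∀ {a} b d → a ℕ.≤ b ℕ.+ d → ℕ→ℚ a ≤ ℕ→ℚ b + ℕ→ℚ d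
  ℕ→ℚ-mono-≤-+ {a} b d a≤b+d = subst (ℕ→ℚ a ≤_) (ℕ→ℚ-+ b d) (ℕ→ℚ-mono-≤ a≤b+d)

sumℚ-map-nonNeg : ∀ {A : Set} (f : A → ℚ) → (∀ x → 0ℚ ≤ f x) → ∀ xs → 0ℚ ≤ sumℚ (map f xs)
sumℚ-map-nonNeg f f≥0 [] = ≤-refl
sumℚ-map-nonNeg f f≥0 (x ∷ xs) =
  subst (_≤ f x + sumℚ (map f xs)) (+-identityʳ 0ℚ) (+-mono-≤ (f≥0 x) (sumℚ-map-nonNeg f f≥0 xs))

edgeWeight-nonNeg : ∀ {n} (w : Weights n) → NonNegWeights w → ∀ S → 0ℚ ≤ edgeWeight w S
edgeWeight-nonNeg {n} w w≥0 S =
  sumℚ-map-nonNeg _ (λ i → sumℚ-map-nonNeg _ (λ j → if-nonNeg _ (w≥0 i j)) (allFin n)) (allFin n)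
  where
  if-nonNeg : ∀ b {x} → 0ℚ ≤ x → 0ℚ ≤ (if b then x else 0ℚ)
  if-nonNeg true  0≤x = 0≤x
  if-nonNeg false _   = ≤-refl

density-empty : ∀ {n} (w : Weights n) S → ∣ S ∣ ≡ 0 → density w S ≡ 0ℚ
density-empty w S ∣S∣≡0 rewrite ∣S∣≡0 = refl

density-*-size : ∀ {n} (w : Weights n) S {m} → ∣ S ∣ ≡ suc m →
  density w S * ℕ→ℚ (suc m) ≡ edgeWeight w S
density-*-size w S {m} ∣S∣≡1+m rewrite ∣S∣≡1+m = begin
  edgeWeight w S * (+ 1 / suc m) * ℕ→ℚ (suc m)    ≡⟨ *-assoc (edgeWeight w S) _ _ ⟩
  edgeWeight w S * ((+ 1 / suc m) * ℕ→ℚ (suc m))  ≡⟨ cong (edgeWeight w S *_) (1/suc-*-ℕ→ℚ m) ⟩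
  edgeWeight w S * 1ℚ                              ≡⟨ *-identityʳ _ ⟩
  edgeWeight w S                                   ∎
  where open ≡-Reasoning

density-nonNeg : ∀ {n} (w : Weights n) → NonNegWeights w → ∀ S → 0ℚ ≤ density w S
density-nonNeg w w≥0 S = by-size _ refl
  where
  open ≤-Reasoning
  by-size : ∀ m → ∣ S ∣ ≡ m → 0ℚ ≤ density w S
  by-size zero    ∣S∣≡0   = ≤-reflexive (sym (density-empty w S ∣S∣≡0))
  by-size (suc m) ∣S∣≡1+m = *-cancelʳ-≤-pos (ℕ→ℚ (suc m)) {{positive (ℕ→ℚ-suc-pos m)}} (begin
    0ℚ * ℕ→ℚ (suc m)          ≡⟨ *-zeroˡ (ℕ→ℚ (suc m)) ⟩
    0ℚ                        ≤⟨ edgeWeight-nonNeg w w≥0 S ⟩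
    edgeWeight w S            ≡⟨ sym (density-*-size w S ∣S∣≡1+m) ⟩
    density w S * ℕ→ℚ (suc m) ∎)

-- With d' = x'/P and d = x/Q this reads: x' ≤ x and a Q ≤ b P give a (x'/P) ≤ b (x/Q).
quotient-scale-≤ : ∀ {a b x x' d d' P Q} → 0ℚ < P → 0ℚ < Q → 0ℚ ≤ a → 0ℚ ≤ x →
  d' * P ≡ x' → d * Q ≡ x → x' ≤ x → a * Q ≤ b * P → a * d' ≤ b * d
quotient-scale-≤ {a} {b} {x} {x'} {d} {d'} {P} {Q} 0<P 0<Q 0≤a 0≤x d'P≡x' dQ≡x x'≤x aQ≤bP =
  *-cancelʳ-≤-pos (P * Q) {{pos*pos⇒pos P Q}} (begin
    a * d' * (P * Q)  ≡⟨ solve 4 (λ a d' P Q → a :* d' :* (P :* Q) := a :* Q :* (d' :* P)) refl a d' P Q ⟩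
    a * Q * (d' * P)  ≡⟨ cong (a * Q *_) d'P≡x' ⟩
    a * Q * x'        ≤⟨ *-monoˡ-≤-nonNeg (a * Q) {{nonNeg*nonNeg⇒nonNeg a Q {{pos⇒nonNeg Q}}}} x'≤x ⟩
    a * Q * x         ≤⟨ *-monoʳ-≤-nonNeg x aQ≤bP ⟩
    b * P * x         ≡⟨ cong (b * P *_) (sym dQ≡x) ⟩
    b * P * (d * Q)   ≡⟨ solve 4 (λ b P d Q → b :* P :* (d :* Q) := b :* d :* (P :* Q)) refl b P d Q ⟩
    b * d * (P * Q)   ∎)
  where
  open ≤-Reasoning
  instance
    _ = positive 0<P
    _ = positive 0<Q
    _ = nonNegative 0≤a
    _ = nonNegative 0≤x

-- The reverse size bound only serves to exclude S = ∅ ≠ S', where d(∅) = 0 would break the claim.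
density-scale-≤ : ∀ {n} (w : Weights n) → NonNegWeights w → ∀ S S' {a b β} →
  0ℚ < a → 0ℚ ≤ b → β * edgeWeight w S' ≤ edgeWeight w S →
  a * ℕ→ℚ ∣ S ∣ ≤ b * ℕ→ℚ ∣ S' ∣ → a * ℕ→ℚ ∣ S' ∣ ≤ b * ℕ→ℚ ∣ S ∣ →
  (a * β) * density w S' ≤ b * density w S
density-scale-≤ w w≥0 S S' {a} {b} {β} 0<a 0≤b βW'≤W aS≤bS' aS'≤bS = by-sizes _ refl _ refl
  where
  open ≤-Reasoning
  instance
    _ = positive 0<a
    _ = nonNegative 0≤b
    _ = nonNegative (density-nonNeg w w≥0 S)
  by-sizes : ∀ p → ∣ S' ∣ ≡ p → ∀ q → ∣ S ∣ ≡ q → (a * β) * density w S' ≤ b * density w S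
  by-sizes zero ∣S'∣≡0 _ _ = begin
    a * β * density w S'  ≡⟨ cong (a * β *_) (density-empty w S' ∣S'∣≡0) ⟩
    a * β * 0ℚ            ≡⟨ *-zeroʳ (a * β) ⟩
    0ℚ                    ≤⟨ nonNegative⁻¹ _ {{nonNeg*nonNeg⇒nonNeg b (density w S)}} ⟩
    b * density w S       ∎
  by-sizes (suc p) ∣S'∣≡1+p zero ∣S∣≡0 = ⊥-elim (<-irrefl refl (begin-strict
    0ℚ               <⟨ positive⁻¹ _ {{pos*pos⇒pos a (ℕ→ℚ (suc p)) {{positive (ℕ→ℚ-suc-pos p)}}}} ⟩
    a * ℕ→ℚ (suc p)  ≡⟨ cong (λ m → a * ℕ→ℚ m) (sym ∣S'∣≡1+p) ⟩
    a * ℕ→ℚ ∣ S' ∣   ≤⟨ aS'≤bS ⟩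
    b * ℕ→ℚ ∣ S ∣    ≡⟨ cong (λ m → b * ℕ→ℚ m) ∣S∣≡0 ⟩
    b * 0ℚ           ≡⟨ *-zeroʳ b ⟩
    0ℚ               ∎))
  by-sizes (suc p) ∣S'∣≡1+p (suc q) ∣S∣≡1+q = begin
    a * β * density w S'    ≡⟨ *-assoc a β _ ⟩
    a * (β * density w S')  ≤⟨ quotient-scale-≤ {b = b} {d = density w S} (ℕ→ℚ-suc-pos p) (ℕ→ℚ-suc-pos q)
                                 (<⇒≤ 0<a) (edgeWeight-nonNeg w w≥0 S) βD'*P≡βW' (density-*-size w S ∣S∣≡1+q)
                                 βW'≤W aQ≤bP ⟩
    b * density w S         ∎
    where
    βD'*P≡βW' : β * density w S' * ℕ→ℚ (suc p) ≡ β * edgeWeight w S'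
    βD'*P≡βW' = trans (*-assoc β _ _) (cong (β *_) (density-*-size w S' ∣S'∣≡1+p))
    aQ≤bP : a * ℕ→ℚ (suc q) ≤ b * ℕ→ℚ (suc p)
    aQ≤bP = subst₂ (λ s s' → a * ℕ→ℚ s ≤ b * ℕ→ℚ s') ∣S∣≡1+q ∣S'∣≡1+p aS≤bS'

lemma2 : ∀ (n : ℕ) (w : Weights n) → NonNegWeights w →
    ∀ (U : Subset n) (k : ℕ) (c α : ℚ) →
    0ℚ < c → c < 1ℚ → ℕ→ℚ k ≤ c * ℕ→ℚ ∣ U ∣ → k Data.Nat.+ ∣ U ∣ Data.Nat.≤ n →
    0ℚ < α → α ≤ 1ℚ →
    ∀ (C : Subset n) → ∣ C ∣ ≡ k →
    (∀ (C' : Subset n) → ∣ C' ∣ ≡ k →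
       α * edgeWeight w (U △ C') ≤ edgeWeight w (U △ C)) →
    ∀ (C' : Subset n) → ∣ C' ∣ ≡ k →
      ((1ℚ - c) * α) * density w (U △ C') ≤ (1ℚ + c) * density w (U △ C)
lemma2 n w w≥0 U k c α 0<c c<1 k≤cu _ _ _ C ∣C∣≡k C-approx C' ∣C'∣≡k =
  density-scale-≤ w w≥0 (U △ C) (U △ C') (p<q⇒0<q-p c<1) (0≤1+p 0≤c) (C-approx C' ∣C'∣≡k)
    (∣U△C∣-ratio-≤ U C C' 0≤c c≤1 k≤cu ∣C∣≡k ∣C'∣≡k)
    (∣U△C∣-ratio-≤ U C' C 0≤c c≤1 k≤cu ∣C'∣≡k ∣C∣≡k)
  where
  0≤c : 0ℚ ≤ c
  0≤c = <⇒≤ 0<c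
  c≤1 : c ≤ 1ℚ
  c≤1 = <⇒≤ c<1
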